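{- Let $l\geq 1$ be an integer and $n$ an integer with $\binom{2l-1}{l-1}<n\leq\binom{2l+1}{l}$. Then $2l\leq C(2,n)\leq 2l+2$.
   Context: For positive integers $d\leq n$, let $S$ be a finite set with $|S|=n$ and $2^S$ its power set. For a family $\mathcal F\subseteq 2^S$ and $A\subseteq S$, the trace of $\mathcal F$ on $A$ is $\mathcal F_A=\{E\cap A : E\in\mathcal F\}$, and $\mathcal F$ shatters $A$ if $\mathcal F_A=2^A$. A $d$-subset of $S$ is a subset of cardinality $d$. The index of $\mathcal F$ is $\operatorname{ind}\mathcal F=\max\{d\in\{0,\dots,n\} : \mathcal F \text{ shatters all } d\text{ -subsets of } S\}$. Define $C(d,n)=\min\{|\mathcal F| : \mathcal F\subseteq 2^S,\ \operatorname{ind}\mathcal F=d\}$ (this depends only on $d$ and $n$). -}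

module Defs where

open import Data.Nat using (ℕ; _≤_; _+_; _*_; _∸_; _<_)
open import Data.Nat.Combinatorics using (_C_)
open import Data.List using (List; length)
open import Data.List.Membership.Propositional using (_∈_)
open import Data.List.Relation.Unary.Unique.Propositional using (Unique)
open import Data.Fin.Subset using (Subset; _∩_; _⊆_; ∣_∣)
open import Data.Product using (Σ; ∃; _×_)
open import Relation.Binary.PropositionalEquality using (_≡_)

-- S = Fin n; a subset of S is a `Subset n`.
-- A family F ⊆ 2^S is a duplicate-free list of subsets; |F| = its length.
record Family (n : ℕ) : Set where
  constructor family
  field
    members  : List (Subset n)
    distinct : Unique members

open Family public

card : ∀ {n} → Family n → ℕ
card F = length (members F)

Shatters : ∀ {n} → Family n → Subset n → Set
Shatters F A = ∀ B → B ⊆ A → ∃ λ E → E ∈ members F × E ∩ A ≡ B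

ShattersAll : ∀ {n} → Family n → ℕ → Set
ShattersAll F d = ∀ A → ∣ A ∣ ≡ d → Shatters F A

HasIndex : ∀ {n} → Family n → ℕ → Set
HasIndex {n} F d = d ≤ n × ShattersAll F d × (∀ e → e ≤ n → ShattersAll F e → e ≤ d)

IsC : ℕ → ℕ → ℕ → Set
IsC d n c = (∃ λ (F : Family n) → HasIndex F d × card F ≡ c)
          × (∀ (F : Family n) → HasIndex F d → c ≤ card F)

-- Lower bound: if F has index 2, then for any two points i ≠ j some member of F
-- contains i but not j, so the columns of the incidence matrix of F form an
-- antichain of n subsets of a |F|-set. In the LYM inequality each A ⊆ [M] is
-- weighted by |A|! (M - |A|)!, the number of maximal chains through A; the weights
-- of an antichain sum to at most M!, and for M = 2l + 1 each weight is at least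
-- l! (l+1)!. Hence |F| ≤ 2l + 1 forces n ≤ C(2l+1, l); with l - 1 for l, C(2, n) ≥ 2l.
--
-- Upper bound: take n distinct l-subsets T₀, T₁, … of a (2l+1)-set whose first
-- three satisfy T₁ ∩ T₂ ⊆ T₀, and let F consist of the whole set and of the sets
-- {i : r ∈ Tᵢ}. On a pair {i, j}, the pattern 11 comes from the whole set, 10 and
-- 01 from Tᵢ ≠ Tⱼ having equal size, and 00 from |Tᵢ ∪ Tⱼ| < 2l + 1; but no member
-- meets {0, 1, 2} in exactly {1, 2}. So F has index 2 and at most 2l + 2 members.
--
-- C(2, n) exists because the index of a family over a finite set is decidable.

module Submission where

open import Defs
open import Level using (0ℓ)
open import Function using (_∘_)
open import Data.Nat using (ℕ; zero; suc; _≤_; _<_; _+_; _*_; _∸_; _!; _≤?_; z≤n; s≤s; s≤s⁻¹; s<s⁻¹)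
open import Data.Nat.Properties
open import Data.Nat.Induction using (<-rec)
open import Data.Nat.Combinatorics using (_C_; nCk≡n!/k![n-k]!; k![n∸k]!∣n!; nCk+nC[k+1]≡[n+1]C[k+1])
open import Data.Nat.Divisibility using (_∣_; ∣⇒≤)
open import Data.Nat.DivMod using (_/_; m/n*n≡m)
open import Data.Nat.ListAction using (sum)
open import Data.Nat.Tactic.RingSolver using (solve-∀)
open import Algebra.Properties.CommutativeSemigroup *-commutativeSemigroup using (x∙yz≈y∙xz)
open import Algebra.Properties.CommutativeMonoid.Sum +-0-commutativeMonoid
  using (sum-syntax; sum-cong-≗; ∑-distrib-+; sum-replicate-zero)
open import Data.Bool using (true; false; _∧_; if_then_else_)
import Data.Bool as Bool
open import Data.Bool.Properties using (∧-identityʳ; ∧-zeroʳ; not-¬)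
open import Data.Empty using (⊥; ⊥-elim)
open import Data.Product using (∃; ∃₂; _×_; _,_; proj₁; proj₂)
open import Data.Sum using (inj₁; inj₂; [_,_]′)
open import Data.Fin using (Fin; zero; suc; punchOut; inject≤)
open import Data.Fin.Properties using (inject≤-injective)
open import Data.Fin.Subset using (Subset; ⁅_⁆; _∪_; _∩_; _⊆_; ∣_∣; ∁; ⊤) renaming (_∈_ to _∈ₛ_; ⊥ to ∅)
open import Data.Fin.Subset.Properties
  using (anySubset?; _⊆?_; ∣p∣≤n; ∣∁p∣≡n∸∣p∣; ∣⊥∣≡0; ∣⁅x⁆∣≡1; ∪-identityˡ; ∪-identityʳ; x∈⁅x⁆; x∈⁅y⁆⇒x≡y;
         x≢y⇒x∉⁅y⁆; p⊆p∪q; x∈p∪q⁺; x∈p∪q⁻; x∈p∩q⁺; x∈p∩q⁻)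
open import Data.Vec using (Vec; []; _∷_; lookup; tabulate; removeAt; here; there)
open import Data.Vec.Properties
  using (≡-dec; removeAt-punchOut; []=⇒lookup; lookup⇒[]=; lookup-zipWith; lookup∘tabulate; lookup-replicate;
         tabulate∘lookup; tabulate-cong; ∷-injectiveʳ)
open import Data.List using (List; []; _∷_; length; map; _++_; allFin; deduplicate)
import Data.List as List
open import Data.List.Properties using (map-cong-local; length-++; length-map; length-tabulate; length-deduplicate)
open import Data.List.Membership.Propositional using (_∈_; find; lose)
open import Data.List.Membership.Propositional.Properties
  using (∈-map⁺; ∈-map⁻; ∈-allFin; ∈-deduplicate⁺; ∈-deduplicate⁻; ∈-lookup)
open import Data.List.Relation.Unary.Any using (here; there; any?)
open import Data.List.Relation.Unary.All using (All; []; _∷_)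
import Data.List.Relation.Unary.All as All
import Data.List.Relation.Unary.All.Properties as All
open import Data.List.Relation.Unary.AllPairs using (AllPairs; []; _∷_; allPairs?)
open import Data.List.Relation.Unary.AllPairs.Properties using () renaming (tabulate⁺ to allPairs-tabulate⁺)
open import Data.List.Relation.Unary.Unique.Propositional using (Unique)
import Data.List.Relation.Unary.Unique.Propositional.Properties as Unique
open import Data.List.Relation.Unary.Unique.DecPropositional.Properties using (deduplicate-!)
open import Relation.Nullary using (Dec; yes; no; ¬_; ¬?; contradiction)
open import Relation.Nullary.Decidable using (map′; _×-dec_; _→-dec_; decidable-stable)
open import Relation.Unary using (Pred; Decidable)
open import Relation.Binary.PropositionalEquality
  using (_≡_; _≢_; refl; sym; trans; cong; cong₂; subst; module ≡-Reasoning)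

_≟ₛ_ : ∀ {n} (p q : Subset n) → Dec (p ≡ q)
_≟ₛ_ = ≡-dec Bool._≟_

allSubsets? : ∀ {n} {Q : Pred (Subset n) 0ℓ} → Decidable Q → Dec (∀ A → Q A)
allSubsets? Q? = map′
  (λ ∄¬Q A → decidable-stable (Q? A) (λ ¬QA → ∄¬Q (A , ¬QA)))
  (λ ∀Q (A , ¬QA) → ¬QA (∀Q A))
  (¬? (anySubset? (¬? ∘ Q?)))

∃-∈? : ∀ {n} {P : Pred (Subset n) 0ℓ} → Decidable P → (xs : List (Subset n))
     → Dec (∃ λ E → E ∈ xs × P E)
∃-∈? P? xs = map′ find (λ (_ , E∈ , PE) → lose E∈ PE) (any? P? xs)

shatters? : ∀ {n} (F : Family n) A → Dec (Shatters F A)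
shatters? F A = allSubsets? λ B → (B ⊆? A) →-dec ∃-∈? (λ E → (E ∩ A) ≟ₛ B) (members F)

shattersAll? : ∀ {n} (F : Family n) d → Dec (ShattersAll F d)
shattersAll? F d = allSubsets? λ A → (∣ A ∣ ≟ d) →-dec shatters? F A

hasIndex? : ∀ {n} (F : Family n) d → Dec (HasIndex F d)
hasIndex? {n} F d = (d ≤? n) ×-dec (shattersAll? F d ×-dec map′
  (λ below e e≤n → below (s≤s e≤n))
  (λ below {e} e<1+n → below e (s≤s⁻¹ e<1+n))
  (allUpTo? (λ e → shattersAll? F e →-dec (e ≤? d)) (suc n)))

∃-list-of-length? : ∀ {n} {P : Pred (List (Subset n)) 0ℓ} → Decidable P
  → ∀ k → Dec (∃ λ xs → length xs ≡ k × P xs)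
∃-list-of-length? P? zero = map′ (λ P[] → [] , refl , P[]) (λ { ([] , _ , P[]) → P[] }) (P? [])
∃-list-of-length? P? (suc k) = map′
  (λ (x , xs , eq , Pxxs) → x ∷ xs , cong suc eq , Pxxs)
  (λ { (x ∷ xs , eq , Pxxs) → x , xs , suc-injective eq , Pxxs })
  (anySubset? λ x → ∃-list-of-length? (P? ∘ (x ∷_)) k)

∃-family-of-card? : ∀ n d k → Dec (∃ λ (F : Family n) → HasIndex F d × card F ≡ k)
∃-family-of-card? n d k = map′
  (λ (xs , eq , u , ind) → family xs u , ind , eq)
  (λ (family xs u , ind , eq) → xs , eq , u , ind)
  (∃-list-of-length? index-d-family? k)
  where
  index-d-family? : (xs : List (Subset n)) → Dec (∃ λ (u : Unique xs) → HasIndex (family xs u) d)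
  index-d-family? xs with allPairs? (λ p q → ¬? (p ≟ₛ q)) xs
  ... | no ¬u = no (¬u ∘ proj₁)
  ... | yes u = map′ (u ,_) (λ (_ , ind) → ind) (hasIndex? (family xs u) d)

least-witness : ∀ {P : Pred ℕ 0ℓ} → Decidable P → ∀ u → P u → ∃ λ c → P c × (∀ {k} → P k → c ≤ k)
least-witness {P} P? = <-rec (λ u → P u → Least) search
  where
  Least : Set
  Least = ∃ λ c → P c × (∀ {k} → P k → c ≤ k)
  search : ∀ u → (∀ {m} → m < u → P m → Least) → P u → Least
  search u smaller Pu with anyUpTo? P? u
  ... | yes (m , m<u , Pm) = smaller m<u Pm
  ... | no ∄m<u = u , Pu , λ {k} Pk → ≮⇒≥ λ k<u → ∄m<u (k , k<u , Pk)

C-exists : ∀ {n d} (F : Family n) → HasIndex F d → ∃ λ c → IsC d n c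
C-exists {n} {d} F ind with least-witness (∃-family-of-card? n d) (card F) (F , ind , refl)
... | c , witness , least = c , witness , λ G indG → least (G , indG , refl)

C-between : ∀ {d n lo hi} → (∀ (F : Family n) → HasIndex F d → lo ≤ card F)
  → (∃ λ (F : Family n) → HasIndex F d × card F ≤ hi) → ∃ λ c → IsC d n c × lo ≤ c × c ≤ hi
C-between {lo = lo} lower (F , index-F , card-F≤hi) with C-exists F index-F
... | c , isC@((G , index-G , card-G≡c) , minimal) =
  c , isC , subst (lo ≤_) card-G≡c (lower G index-G) , ≤-trans (minimal F index-F) card-F≤hi

m!*n!∣[m+n]! : ∀ m n → m ! * n ! ∣ (m + n) !
m!*n!∣[m+n]! m n = subst (λ k → m ! * k ! ∣ (m + n) !) (m+n∸m≡n m n) (k![n∸k]!∣n! (m≤m+n m n))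

m!*n!≤[m+n]! : ∀ m n → m ! * n ! ≤ (m + n) !
m!*n!≤[m+n]! m n = ∣⇒≤ {{(m + n) !≢0}} (m!*n!∣[m+n]! m n)

[m+n]Cm*[m!*n!]≡[m+n]! : ∀ m n → ((m + n) C m) * (m ! * n !) ≡ (m + n) !
[m+n]Cm*[m!*n!]≡[m+n]! m n = begin
  ((m + n) C m) * (m ! * n !)   ≡⟨ cong (λ k → ((m + n) C m) * (m ! * k !)) (sym (m+n∸m≡n m n)) ⟩
  ((m + n) C m) * d             ≡⟨ cong (_* d) (nCk≡n!/k![n-k]! (m≤m+n m n)) ⟩
  ((m + n) ! / d) * d           ≡⟨ m/n*n≡m (k![n∸k]!∣n! (m≤m+n m n)) ⟩
  (m + n) !                     ∎
  where
  open ≡-Reasoning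
  d = m ! * (m + n ∸ m) !
  instance _ = m !* (m + n ∸ m) !≢0

0<[m+n]Cm : ∀ m n → 0 < (m + n) C m
0<[m+n]Cm m n with (m + n) C m in eq
... | suc _ = s≤s z≤n
... | zero = contradiction (trans (sym (cong (_* (m ! * n !)) eq)) ([m+n]Cm*[m!*n!]≡[m+n]! m n)) (<⇒≢ (1≤n! (m + n)))

-- Each step trades (b+1)! Y! for b! (Y+1)!, which is no smaller as b ≤ Y.
[b+t]!*[1+b+t]!≤b!*[1+b+2t]! : ∀ b t → (b + t) ! * suc (b + t) ! ≤ b ! * suc (b + t + t) !
[b+t]!*[1+b+t]!≤b!*[1+b+2t]! b zero rewrite +-identityʳ b | +-identityʳ b = ≤-refl
[b+t]!*[1+b+t]!≤b!*[1+b+2t]! b (suc t) = begin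
  (b + suc t) ! * suc (b + suc t) ! ≡⟨ cong (λ k → k ! * suc k !) (+-suc b t) ⟩
  (suc b + t) ! * suc (suc b + t) ! ≤⟨ [b+t]!*[1+b+t]!≤b!*[1+b+2t]! (suc b) t ⟩
  (suc b * b !) * Y !                ≡⟨ *-assoc (suc b) (b !) (Y !) ⟩
  suc b * (b ! * Y !)                ≡⟨ x∙yz≈y∙xz (suc b) (b !) (Y !) ⟩
  b ! * (suc b * Y !)                ≤⟨ *-monoʳ-≤ (b !) (*-monoˡ-≤ (Y !) (s≤s b≤Y)) ⟩
  b ! * suc Y !                      ≡⟨ cong (λ k → b ! * suc k !) (b+2t+2≡b+[1+t]+[1+t] b t) ⟩
  b ! * suc (b + suc t + suc t) !    ∎
  where
  open ≤-Reasoning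
  Y = suc (suc (b + t + t))
  b≤Y : b ≤ Y
  b≤Y = m≤n⇒m≤o+n 2 (≤-trans (m≤m+n b t) (m≤m+n (b + t) t))
  b+2t+2≡b+[1+t]+[1+t] : ∀ b t → suc (suc (b + t + t)) ≡ b + suc t + suc t
  b+2t+2≡b+[1+t]+[1+t] = solve-∀

l!*[1+l]!≤a!*b! : ∀ l a b → a + b ≡ suc (l + l) → l ! * suc l ! ≤ a ! * b !
l!*[1+l]!≤a!*b! l a b a+b≡ = [ larger-first a+b≡ , smaller-first ]′ (≤-total b a)
  where
  larger-first : ∀ {a b} → a + b ≡ suc (l + l) → b ≤ a → l ! * suc l ! ≤ a ! * b !
  larger-first {a} {b} a+b≡ b≤a = subst (λ k → k ! * suc k ! ≤ a ! * b !) b+t≡l balanced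
    where
    b≤l : b ≤ l
    b≤l = ≮⇒≥ λ l<b → 1+n≰n (begin
      suc (suc (l + l)) ≡⟨ cong suc (+-suc l l) ⟨
      suc l + suc l     ≤⟨ +-mono-≤ (≤-trans l<b b≤a) l<b ⟩
      a + b             ≡⟨ a+b≡ ⟩
      suc (l + l)       ∎)
      where open ≤-Reasoning
    t = l ∸ b
    b+t≡l : b + t ≡ l
    b+t≡l = m+[n∸m]≡n b≤l
    a≡1+b+2t : a ≡ suc (b + t + t)
    a≡1+b+2t = +-cancelʳ-≡ b a _
      (trans a+b≡ (trans (cong (λ k → suc (k + k)) (sym b+t≡l)) (2[b+t]+1≡[1+b+2t]+b b t)))
      where
      2[b+t]+1≡[1+b+2t]+b : ∀ b t → suc ((b + t) + (b + t)) ≡ suc (b + t + t) + b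
      2[b+t]+1≡[1+b+2t]+b = solve-∀
    balanced : (b + t) ! * suc (b + t) ! ≤ a ! * b !
    balanced rewrite a≡1+b+2t | *-comm (suc (b + t + t) !) (b !) = [b+t]!*[1+b+t]!≤b!*[1+b+2t]! b t
  smaller-first : a ≤ b → l ! * suc l ! ≤ a ! * b !
  smaller-first a≤b = subst (l ! * suc l ! ≤_) (*-comm (b !) (a !)) (larger-first (trans (+-comm b a) a+b≡) a≤b)

infix 4 _⊈_

_⊈_ : ∀ {m} → Subset m → Subset m → Set
A ⊈ B = ∃ λ r → lookup A r ≡ true × lookup B r ≡ false

Antichain : ∀ {m} → List (Subset m) → Set
Antichain = AllPairs (λ A B → A ⊈ B × B ⊈ A)

Avoids : ∀ {m} → Subset m → Set
Avoids A = ∃ λ x → lookup A x ≡ false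

weight : ∀ {m} → Subset m → ℕ
weight A = ∣ A ∣ ! * ∣ ∁ A ∣ !

∣p∣+∣∁p∣≡n : ∀ {m} (A : Subset m) → ∣ A ∣ + ∣ ∁ A ∣ ≡ m
∣p∣+∣∁p∣≡n A = trans (cong (∣ A ∣ +_) (∣∁p∣≡n∸∣p∣ A)) (m+[n∸m]≡n (∣p∣≤n A))

weight≤m! : ∀ {m} (A : Subset m) → weight A ≤ m !
weight≤m! {m} A = subst (λ k → weight A ≤ k !) (∣p∣+∣∁p∣≡n A) (m!*n!≤[m+n]! ∣ A ∣ ∣ ∁ A ∣)

removeAt-avoided : ∀ {m} (A : Subset (suc m)) x → lookup A x ≡ false
  → ∣ removeAt A x ∣ ≡ ∣ A ∣ × suc ∣ ∁ (removeAt A x) ∣ ≡ ∣ ∁ A ∣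
removeAt-avoided (false ∷ A) zero refl = refl , refl
removeAt-avoided (a ∷ b ∷ A) (suc x) b∉ with removeAt-avoided (b ∷ A) x b∉
removeAt-avoided (true ∷ b ∷ A) (suc x) b∉ | e₁ , e₂ = cong suc e₁ , e₂
removeAt-avoided (false ∷ b ∷ A) (suc x) b∉ | e₁ , e₂ = e₁ , cong suc e₂

removeAt-⊈ : ∀ {m} (x : Fin (suc m)) {A B : Subset (suc m)} → lookup A x ≡ false
  → A ⊈ B → removeAt A x ⊈ removeAt B x
removeAt-⊈ x {A} {B} x∉A (r , r∈A , r∉B) =
  punchOut x≢r , trans (removeAt-punchOut A x≢r) r∈A , trans (removeAt-punchOut B x≢r) r∉B
  where
  x≢r : x ≢ r
  x≢r refl with trans (sym x∉A) r∈A
  ... | ()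

∑-avoided : ∀ {m} (A : Subset m) c → ∑[ x < m ] (if lookup A x then 0 else c) ≡ ∣ ∁ A ∣ * c
∑-avoided [] c = refl
∑-avoided (true ∷ A) c = ∑-avoided A c
∑-avoided (false ∷ A) c = cong (c +_) (∑-avoided A c)

∑-bounded : ∀ {k} (f : Fin k → ℕ) {c} → (∀ x → f x ≤ c) → ∑[ x < k ] f x ≤ k * c
∑-bounded {zero} f f≤c = z≤n
∑-bounded {suc k} f f≤c = +-mono-≤ (f≤c zero) (∑-bounded (λ x → f (suc x)) (λ x → f≤c (suc x)))

sum-map-∑ : ∀ {A : Set} {k} (g : Fin k → A → ℕ) (As : List A)
  → sum (map (λ a → ∑[ x < k ] g x a) As) ≡ ∑[ x < k ] sum (map (g x) As)
sum-map-∑ {k = k} g [] = sym (sum-replicate-zero k)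
sum-map-∑ g (a ∷ As) = trans (cong (_ +_) (sum-map-∑ g As)) (sym (∑-distrib-+ (λ x → g x a) _))

removalWeight : ∀ {m} → Fin (suc m) → Subset (suc m) → ℕ
removalWeight x A = if lookup A x then 0 else weight (removeAt A x)

weight-decomposition : ∀ {m} (A : Subset (suc m)) → Avoids A → weight A ≡ ∑[ x < suc m ] removalWeight x A
weight-decomposition {m} A (x , x∉A) = begin
  ∣ A ∣ ! * ∣ ∁ A ∣ !                           ≡⟨ cong (λ f → ∣ A ∣ ! * f !) (sym 1+k≡∣∁A∣) ⟩
  ∣ A ∣ ! * (suc k * k !)                       ≡⟨ x∙yz≈y∙xz (∣ A ∣ !) (suc k) (k !) ⟩
  suc k * c                                     ≡⟨ cong (_* c) 1+k≡∣∁A∣ ⟩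
  ∣ ∁ A ∣ * c                                   ≡⟨ ∑-avoided A c ⟨
  ∑[ y < suc m ] (if lookup A y then 0 else c)  ≡⟨ sum-cong-≗ removalWeight≡ ⟩
  ∑[ y < suc m ] removalWeight y A             ∎
  where
  open ≡-Reasoning
  k = ∣ ∁ (removeAt A x) ∣
  1+k≡∣∁A∣ : suc k ≡ ∣ ∁ A ∣
  1+k≡∣∁A∣ = proj₂ (removeAt-avoided A x x∉A)
  c = ∣ A ∣ ! * k !
  removalWeight≡ : ∀ y → (if lookup A y then 0 else c) ≡ removalWeight y A
  removalWeight≡ y with lookup A y in y∉A
  ... | true = refl
  ... | false with removeAt-avoided A y y∉A
  ...   | e₁ , e₂ = cong₂ (λ a f → a ! * f !) (sym e₁) (suc-injective (trans 1+k≡∣∁A∣ (sym e₂)))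

restrict : ∀ {m} → Fin (suc m) → List (Subset (suc m)) → List (Subset m)
restrict x [] = []
restrict x (A ∷ As) with lookup A x
... | true = restrict x As
... | false = removeAt A x ∷ restrict x As

sum-removalWeight : ∀ {m} (x : Fin (suc m)) As
  → sum (map (removalWeight x) As) ≡ sum (map weight (restrict x As))
sum-removalWeight x [] = refl
sum-removalWeight x (A ∷ As) with lookup A x
... | true = sum-removalWeight x As
... | false = cong (weight (removeAt A x) +_) (sum-removalWeight x As)

restrict-antichain : ∀ {m} (x : Fin (suc m)) {As} → Antichain As → Antichain (restrict x As)
restrict-antichain x {[]} [] = []
restrict-antichain x {A ∷ As} (A∥As ∷ anti) with lookup A x in x∉A
... | true = restrict-antichain x anti
... | false = restrict-incomparable A∥As ∷ restrict-antichain x anti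
  where
  restrict-incomparable : ∀ {Bs} → All (λ B → A ⊈ B × B ⊈ A) Bs
    → All (λ B → removeAt A x ⊈ B × B ⊈ removeAt A x) (restrict x Bs)
  restrict-incomparable {[]} [] = []
  restrict-incomparable {B ∷ Bs} ((A⊈B , B⊈A) ∷ A∥Bs) with lookup B x in x∉B
  ... | true = restrict-incomparable A∥Bs
  ... | false = (removeAt-⊈ x {A} {B} x∉A A⊈B , removeAt-⊈ x {B} {A} x∉B B⊈A) ∷ restrict-incomparable A∥Bs

antichain-avoids : ∀ {m} {A B : Subset m} {Cs} → Antichain (A ∷ B ∷ Cs) → All Avoids (A ∷ B ∷ Cs)
antichain-avoids {A = A} (A∥BCs@((_ , (r , _ , r∉A)) ∷ _) ∷ _) = (r , r∉A) ∷ All.map (λ {B} → avoided {B}) A∥BCs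
  where
  avoided : ∀ {B} → A ⊈ B × B ⊈ A → Avoids B
  avoided ((r , _ , r∉B) , _) = r , r∉B

lym-inequality : ∀ m (As : List (Subset m)) → Antichain As → sum (map weight As) ≤ m !
lym-inequality m [] _ = z≤n
lym-inequality m (A ∷ []) _ = subst (_≤ m !) (sym (+-identityʳ (weight A))) (weight≤m! A)
lym-inequality zero (A ∷ B ∷ Cs) ((((() , _) , _) ∷ _) ∷ _)
lym-inequality (suc m) As@(_ ∷ _ ∷ _) anti = begin
  sum (map weight As)
    ≡⟨ cong sum (map-cong-local (All.map (λ {A} → weight-decomposition A) (antichain-avoids anti))) ⟩
  sum (map (λ A → ∑[ x < suc m ] removalWeight x A) As)
    ≡⟨ sum-map-∑ removalWeight As ⟩
  ∑[ x < suc m ] sum (map (removalWeight x) As)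
    ≡⟨ sum-cong-≗ (λ x → sum-removalWeight x As) ⟩
  ∑[ x < suc m ] sum (map weight (restrict x As))
    ≤⟨ ∑-bounded _ (λ x → lym-inequality m (restrict x As) (restrict-antichain x anti)) ⟩
  suc m * m ! ∎
  where open ≤-Reasoning

∣⁅i⁆∪⁅j⁆∣≡2 : ∀ {n} {i j : Fin n} → i ≢ j → ∣ ⁅ i ⁆ ∪ ⁅ j ⁆ ∣ ≡ 2
∣⁅i⁆∪⁅j⁆∣≡2 {i = zero} {zero} i≢j = ⊥-elim (i≢j refl)
∣⁅i⁆∪⁅j⁆∣≡2 {i = zero} {suc j} _ = cong suc (trans (cong ∣_∣ (∪-identityˡ ⁅ j ⁆)) (∣⁅x⁆∣≡1 j))
∣⁅i⁆∪⁅j⁆∣≡2 {i = suc i} {zero} _ = cong suc (trans (cong ∣_∣ (∪-identityʳ ⁅ i ⁆)) (∣⁅x⁆∣≡1 i))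
∣⁅i⁆∪⁅j⁆∣≡2 {i = suc i} {suc j} i≢j = ∣⁅i⁆∪⁅j⁆∣≡2 (i≢j ∘ cong suc)

separating-member : ∀ {n} (F : Family n) → ShattersAll F 2 → ∀ {i j} → i ≢ j
  → ∃ λ E → E ∈ members F × lookup E i ≡ true × lookup E j ≡ false
separating-member F shatters {i} {j} i≢j
  with shatters (⁅ i ⁆ ∪ ⁅ j ⁆) (∣⁅i⁆∪⁅j⁆∣≡2 i≢j) ⁅ i ⁆ (p⊆p∪q ⁅ j ⁆)
... | E , E∈F , E∩ij≡i = E , E∈F , []=⇒lookup i∈E , j∉E
  where
  i∈E : i ∈ₛ E
  i∈E = proj₁ (x∈p∩q⁻ E _ (subst (i ∈ₛ_) (sym E∩ij≡i) (x∈⁅x⁆ i)))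
  j∉E : lookup E j ≡ false
  j∉E with lookup E j in j∈E
  ... | false = refl
  ... | true = contradiction
    (subst (j ∈ₛ_) E∩ij≡i (x∈p∩q⁺ (lookup⇒[]= j E j∈E , x∈p∪q⁺ (inj₂ (x∈⁅x⁆ j)))))
    (x≢y⇒x∉⁅y⁆ (i≢j ∘ sym))

-- Column i of the incidence matrix of the members, padded with zeros to length M.
column : ∀ {n} → List (Subset n) → (M : ℕ) → Fin n → Subset M
column [] M i = ∅
column (E ∷ Es) zero i = []
column (E ∷ Es) (suc M) i = lookup E i ∷ column Es M i

column-position : ∀ {n} {E : Subset n} {Es} {M} → E ∈ Es → length Es ≤ M
  → ∃ λ r → ∀ i → lookup (column Es M i) r ≡ lookup E i
column-position {M = suc M} (here refl) _ = zero , λ i → refl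
column-position {M = suc M} (there E∈Es) (s≤s le) with column-position E∈Es le
... | r , at-r = suc r , at-r

columns-antichain : ∀ {n} (F : Family n) {M} → ShattersAll F 2 → card F ≤ M
  → Antichain (List.tabulate (column (members F) M))
columns-antichain F shatters le = allPairs-tabulate⁺ λ i≢j → column-⊈ i≢j , column-⊈ (i≢j ∘ sym)
  where
  column-⊈ : ∀ {i j} → i ≢ j → column (members F) _ i ⊈ column (members F) _ j
  column-⊈ i≢j with separating-member F shatters i≢j
  ... | E , E∈F , i∈E , j∉E with column-position E∈F le
  ...   | r , at-r = r , trans (at-r _) i∈E , trans (at-r _) j∉E

length*k≤sum : ∀ {A : Set} (f : A → ℕ) {k} → (∀ a → k ≤ f a) → ∀ as → length as * k ≤ sum (map f as)
length*k≤sum f k≤f [] = z≤n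
length*k≤sum f k≤f (a ∷ as) = +-mono-≤ (k≤f a) (length*k≤sum f k≤f as)

n≤[2l+1]Cl : ∀ l {n} (F : Family n) → ShattersAll F 2 → card F ≤ suc (l + l) → n ≤ (l + suc l) C l
n≤[2l+1]Cl l {n} F shatters le = *-cancelʳ-≤ n _ (l ! * suc l !) {{l !* suc l !≢0}} (begin
  n * (l ! * suc l !)                       ≡⟨ cong (_* (l ! * suc l !)) (length-tabulate (column (members F) M)) ⟨
  length columns * (l ! * suc l !)          ≤⟨ length*k≤sum weight weight-bound columns ⟩
  sum (map weight columns)                  ≤⟨ lym-inequality M columns (columns-antichain F shatters le) ⟩
  M !                                       ≡⟨ cong _! (+-suc l l) ⟨
  (l + suc l) !                             ≡⟨ [m+n]Cm*[m!*n!]≡[m+n]! l (suc l) ⟨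
  ((l + suc l) C l) * (l ! * suc l !)       ∎)
  where
  open ≤-Reasoning
  M = suc (l + l)
  columns = List.tabulate (column (members F) M)
  weight-bound : ∀ (A : Subset M) → l ! * suc l ! ≤ weight A
  weight-bound A = l!*[1+l]!≤a!*b! l ∣ A ∣ ∣ ∁ A ∣ (∣p∣+∣∁p∣≡n A)

subsetsOfSize : ∀ m → ℕ → List (Subset m)
subsetsOfSize m zero = ∅ ∷ []
subsetsOfSize zero (suc k) = []
subsetsOfSize (suc m) (suc k) = map (true ∷_) (subsetsOfSize m k) ++ map (false ∷_) (subsetsOfSize m (suc k))

length-subsetsOfSize : ∀ m k → length (subsetsOfSize m k) ≡ m C k
length-subsetsOfSize m zero = refl
length-subsetsOfSize zero (suc k) = refl
length-subsetsOfSize (suc m) (suc k) = begin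
  length (map (true ∷_) (subsetsOfSize m k) ++ map (false ∷_) (subsetsOfSize m (suc k)))
    ≡⟨ length-++ (map (true ∷_) (subsetsOfSize m k)) ⟩
  length (map (true ∷_) (subsetsOfSize m k)) + length (map (false ∷_) (subsetsOfSize m (suc k)))
    ≡⟨ cong₂ _+_ (length-map _ (subsetsOfSize m k)) (length-map _ (subsetsOfSize m (suc k))) ⟩
  length (subsetsOfSize m k) + length (subsetsOfSize m (suc k))
    ≡⟨ cong₂ _+_ (length-subsetsOfSize m k) (length-subsetsOfSize m (suc k)) ⟩
  m C k + m C suc k
    ≡⟨ nCk+nC[k+1]≡[n+1]C[k+1] m k ⟩
  suc m C suc k ∎
  where open ≡-Reasoning

∣subsetsOfSize∣ : ∀ m k → All (λ T → ∣ T ∣ ≡ k) (subsetsOfSize m k)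
∣subsetsOfSize∣ m zero = ∣⊥∣≡0 m ∷ []
∣subsetsOfSize∣ zero (suc k) = []
∣subsetsOfSize∣ (suc m) (suc k) = All.++⁺
  (All.map⁺ (All.map (cong suc) (∣subsetsOfSize∣ m k)))
  (All.map⁺ (∣subsetsOfSize∣ m (suc k)))

subsetsOfSize-unique : ∀ m k → Unique (subsetsOfSize m k)
subsetsOfSize-unique m zero = [] ∷ []
subsetsOfSize-unique zero (suc k) = []
subsetsOfSize-unique (suc m) (suc k) = Unique.++⁺
  (Unique.map⁺ ∷-injectiveʳ (subsetsOfSize-unique m k))
  (Unique.map⁺ ∷-injectiveʳ (subsetsOfSize-unique m (suc k)))
  λ (p , q) → head-differs (∈-map⁻ (true ∷_) p) (∈-map⁻ (false ∷_) q)
  where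
  head-differs : ∀ {T : Subset (suc m)} {P Q : Subset m → Set}
    → (∃ λ A → P A × T ≡ true ∷ A) → (∃ λ B → Q B × T ≡ false ∷ B) → ⊥
  head-differs (_ , _ , refl) (_ , _ , ())

StartsCovered : ∀ {m} → List (Subset m) → Set
StartsCovered L = ∃ λ a → ∃ λ b → ∃ λ c → ∃ λ rest → L ≡ a ∷ b ∷ c ∷ rest
  × (∀ r → lookup b r ≡ true → lookup c r ≡ true → lookup a r ≡ true)

-- The first three are {0..k}, {0..k-1,k+1} and {0..k-1,k+2}.
subsetsOfSize-startsCovered : ∀ k d → StartsCovered (subsetsOfSize (suc k + suc (suc d)) (suc k))
subsetsOfSize-startsCovered zero d = _ , _ , _ , _ , refl , covered
  where
  covered : ∀ r → lookup (false ∷ true ∷ ∅) r ≡ true → lookup (false ∷ false ∷ true ∷ ∅) r ≡ true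
          → lookup (true ∷ ∅ {suc (suc d)}) r ≡ true
  covered (suc zero) _ ()
  covered (suc (suc r)) r∈b _ with trans (sym (lookup-replicate r false)) r∈b
  ... | ()
subsetsOfSize-startsCovered (suc k) d with subsetsOfSize-startsCovered k d
... | a , b , c , rest , L≡abc , covered =
  true ∷ a , true ∷ b , true ∷ c , _ , cong (λ L → map (true ∷_) L ++ rest′) L≡abc , covered′
  where
  rest′ = map (false ∷_) (subsetsOfSize (suc k + suc (suc d)) (suc (suc k)))
  covered′ : ∀ r → lookup (true ∷ b) r ≡ true → lookup (true ∷ c) r ≡ true → lookup (true ∷ a) r ≡ true
  covered′ zero _ _ = refl
  covered′ (suc r) = covered r

lookup-extensional : ∀ {A : Set} {m} (u v : Vec A m) → (∀ x → lookup u x ≡ lookup v x) → u ≡ v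
lookup-extensional u v eq = trans (sym (tabulate∘lookup u)) (trans (tabulate-cong eq) (tabulate∘lookup v))

∣p∣≡0⇒p≡⊥ : ∀ {n} (A : Subset n) → ∣ A ∣ ≡ 0 → A ≡ ∅
∣p∣≡0⇒p≡⊥ [] _ = refl
∣p∣≡0⇒p≡⊥ (false ∷ A) ∣A∣≡0 = cong (false ∷_) (∣p∣≡0⇒p≡⊥ A ∣A∣≡0)

∣p∣≡1⇒p≡⁅x⁆ : ∀ {n} (A : Subset n) → ∣ A ∣ ≡ 1 → ∃ λ i → A ≡ ⁅ i ⁆
∣p∣≡1⇒p≡⁅x⁆ (true ∷ A) ∣A∣≡1 = zero , cong (true ∷_) (∣p∣≡0⇒p≡⊥ A (suc-injective ∣A∣≡1))
∣p∣≡1⇒p≡⁅x⁆ (false ∷ A) ∣A∣≡1 with ∣p∣≡1⇒p≡⁅x⁆ A ∣A∣≡1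
... | i , A≡⁅i⁆ = suc i , cong (false ∷_) A≡⁅i⁆

∣p∣≡2⇒p≡⁅x⁆∪⁅y⁆ : ∀ {n} (A : Subset n) → ∣ A ∣ ≡ 2 → ∃₂ λ i j → i ≢ j × A ≡ ⁅ i ⁆ ∪ ⁅ j ⁆
∣p∣≡2⇒p≡⁅x⁆∪⁅y⁆ (true ∷ A) ∣A∣≡2 with ∣p∣≡1⇒p≡⁅x⁆ A (suc-injective ∣A∣≡2)
... | j , A≡⁅j⁆ = zero , suc j , (λ ()) , cong (true ∷_) (trans A≡⁅j⁆ (sym (∪-identityˡ ⁅ j ⁆)))
∣p∣≡2⇒p≡⁅x⁆∪⁅y⁆ (false ∷ A) ∣A∣≡2 with ∣p∣≡2⇒p≡⁅x⁆∪⁅y⁆ A ∣A∣≡2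
... | i , j , i≢j , A≡ij = suc i , suc j , (λ { refl → i≢j refl }) , cong (false ∷_) A≡ij

Realizes : ∀ {n} → Family n → Fin n → Fin n → Set
Realizes F i j = ∀ a b → ∃ λ E → E ∈ members F × lookup E i ≡ a × lookup E j ≡ b

realizes⇒shatters-pair : ∀ {n} (F : Family n) {i j} → Realizes F i j → Shatters F (⁅ i ⁆ ∪ ⁅ j ⁆)
realizes⇒shatters-pair F {i} {j} realizes B B⊆ij with realizes (lookup B i) (lookup B j)
... | E , E∈F , Ei≡Bi , Ej≡Bj = E , E∈F , lookup-extensional _ B agree
  where
  agree : ∀ x → lookup (E ∩ (⁅ i ⁆ ∪ ⁅ j ⁆)) x ≡ lookup B x
  agree x rewrite lookup-zipWith _∧_ x E (⁅ i ⁆ ∪ ⁅ j ⁆) with lookup (⁅ i ⁆ ∪ ⁅ j ⁆) x in x∈ij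
  ... | true with x∈p∪q⁻ ⁅ i ⁆ ⁅ j ⁆ (lookup⇒[]= x _ x∈ij)
  ...   | inj₁ x∈⁅i⁆ rewrite x∈⁅y⁆⇒x≡y i x∈⁅i⁆ = trans (∧-identityʳ _) Ei≡Bi
  ...   | inj₂ x∈⁅j⁆ rewrite x∈⁅y⁆⇒x≡y j x∈⁅j⁆ = trans (∧-identityʳ _) Ej≡Bj
  agree x | false with lookup B x in x∈B
  ...   | false = ∧-zeroʳ _
  ...   | true with trans (sym ([]=⇒lookup (B⊆ij (lookup⇒[]= x B x∈B)))) x∈ij
  ...     | ()

realizes⇒shattersAll2 : ∀ {n} (F : Family n) → (∀ {i j} → i ≢ j → Realizes F i j) → ShattersAll F 2
realizes⇒shattersAll2 F realizes A ∣A∣≡2 with ∣p∣≡2⇒p≡⁅x⁆∪⁅y⁆ A ∣A∣≡2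
... | i , j , i≢j , refl = realizes⇒shatters-pair F (realizes i≢j)

initialSegment : ∀ {n} → ℕ → Subset n
initialSegment {zero} e = []
initialSegment {suc n} zero = ∅
initialSegment {suc n} (suc e) = true ∷ initialSegment e

∣initialSegment∣ : ∀ {n} e → e ≤ n → ∣ initialSegment {n} e ∣ ≡ e
∣initialSegment∣ {zero} zero _ = refl
∣initialSegment∣ {suc n} zero _ = ∣⊥∣≡0 (suc n)
∣initialSegment∣ {suc n} (suc e) (s≤s e≤n) = cong suc (∣initialSegment∣ e e≤n)

-- The initial segment of size e contains {0, 1, 2}; shattering it needs a member realising 011.
¬shattersAll-beyond-2 : ∀ {n} (F : Family (3 + n))
  → (∀ E → E ∈ members F
       → lookup E zero ≡ false → lookup E (suc zero) ≡ true → lookup E (suc (suc zero)) ≡ true → ⊥)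
  → ∀ e → 3 ≤ e → e ≤ 3 + n → ¬ ShattersAll F e
¬shattersAll-beyond-2 {n} F misses-011 e@(suc (suc (suc _))) (s≤s (s≤s (s≤s _))) e≤ shatters
  with shatters (initialSegment e) (∣initialSegment∣ e e≤) B B⊆A
  where
  B : Subset (3 + n)
  B = false ∷ true ∷ true ∷ ∅
  B⊆A : B ⊆ initialSegment e
  B⊆A (there here) = there here
  B⊆A (there (there here)) = there (there here)
  B⊆A {suc (suc (suc y))} (there (there (there y∈∅))) with trans (sym (lookup-replicate y false)) ([]=⇒lookup y∈∅)
  ... | ()
... | E , E∈F , E∩A≡B = misses-011 E E∈F (agree zero refl) (agree (suc zero) refl) (agree (suc (suc zero)) refl)
  where
  agree : ∀ x → lookup (initialSegment {3 + n} e) x ≡ true → lookup E x ≡ lookup (false ∷ true ∷ true ∷ ∅) x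
  agree x x∈A = begin
    lookup E x                             ≡⟨ ∧-identityʳ _ ⟨
    lookup E x ∧ true                      ≡⟨ cong (lookup E x ∧_) x∈A ⟨
    lookup E x ∧ lookup (initialSegment e) x ≡⟨ lookup-zipWith _∧_ x E _ ⟨
    lookup (E ∩ initialSegment e) x        ≡⟨ cong (λ A → lookup A x) E∩A≡B ⟩
    lookup (false ∷ true ∷ true ∷ ∅) x     ∎
    where open ≡-Reasoning

∣q∣≤∣p∣⇒p≢q⇒p⊈q : ∀ {m} (A B : Subset m) → ∣ B ∣ ≤ ∣ A ∣ → A ≢ B → A ⊈ B
∣q∣≤∣p∣⇒p≢q⇒p⊈q [] [] _ A≢B = ⊥-elim (A≢B refl)
∣q∣≤∣p∣⇒p≢q⇒p⊈q (true ∷ A) (false ∷ B) _ _ = zero , refl , refl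
∣q∣≤∣p∣⇒p≢q⇒p⊈q (true ∷ A) (true ∷ B) ∣B∣≤∣A∣ A≢B
  with ∣q∣≤∣p∣⇒p≢q⇒p⊈q A B (s≤s⁻¹ ∣B∣≤∣A∣) (A≢B ∘ cong (true ∷_))
... | r , r∈A , r∉B = suc r , r∈A , r∉B
∣q∣≤∣p∣⇒p≢q⇒p⊈q (false ∷ A) (false ∷ B) ∣B∣≤∣A∣ A≢B
  with ∣q∣≤∣p∣⇒p≢q⇒p⊈q A B ∣B∣≤∣A∣ (A≢B ∘ cong (false ∷_))
... | r , r∈A , r∉B = suc r , r∈A , r∉B
∣q∣≤∣p∣⇒p≢q⇒p⊈q (false ∷ A) (true ∷ B) ∣B∣≤∣A∣ A≢B
  with ∣q∣≤∣p∣⇒p≢q⇒p⊈q A B (≤-trans (n≤1+n _) ∣B∣≤∣A∣) (λ { refl → 1+n≰n ∣B∣≤∣A∣ })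
... | r , r∈A , r∉B = suc r , r∈A , r∉B

∣p∣+∣q∣<n⇒∃∉p∪q : ∀ {m} (A B : Subset m) → ∣ A ∣ + ∣ B ∣ < m
  → ∃ λ r → lookup A r ≡ false × lookup B r ≡ false
∣p∣+∣q∣<n⇒∃∉p∪q (false ∷ A) (false ∷ B) _ = zero , refl , refl
∣p∣+∣q∣<n⇒∃∉p∪q (true ∷ A) (false ∷ B) lt with ∣p∣+∣q∣<n⇒∃∉p∪q A B (s<s⁻¹ lt)
... | r , r∉A , r∉B = suc r , r∉A , r∉B
∣p∣+∣q∣<n⇒∃∉p∪q {suc m} (false ∷ A) (true ∷ B) lt with ∣p∣+∣q∣<n⇒∃∉p∪q A B (s<s⁻¹ (subst (_< suc m) (+-suc ∣ A ∣ ∣ B ∣) lt))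
... | r , r∉A , r∉B = suc r , r∉A , r∉B
∣p∣+∣q∣<n⇒∃∉p∪q (true ∷ A) (true ∷ B) lt with ∣p∣+∣q∣<n⇒∃∉p∪q A B (<-trans (+-monoʳ-< ∣ A ∣ (n<1+n ∣ B ∣)) (s<s⁻¹ lt))
... | r , r∉A , r∉B = suc r , r∉A , r∉B

lookup-injective : ∀ {A : Set} {xs : List A} → Unique xs → ∀ {i j} → List.lookup xs i ≡ List.lookup xs j → i ≡ j
lookup-injective {xs = _ ∷ _} _ {zero} {zero} _ = refl
lookup-injective {xs = _ ∷ xs} (x∉xs ∷ _) {zero} {suc j} x≡ = ⊥-elim (All.lookup x∉xs (∈-lookup j) x≡)
lookup-injective {xs = _ ∷ xs} (x∉xs ∷ _) {suc i} {zero} ≡x = ⊥-elim (All.lookup x∉xs (∈-lookup i) (sym ≡x))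
lookup-injective {xs = _ ∷ xs} (_ ∷ unique) {suc i} {suc j} eq = cong suc (lookup-injective unique eq)

module Dual {m n} (L : List (Subset m)) (n≤∣L∣ : n ≤ length L) where

  T : Fin n → Subset m
  T i = List.lookup L (inject≤ i n≤∣L∣)

  row : Fin m → Subset n
  row r = tabulate λ i → lookup (T i) r

  rows : List (Subset n)
  rows = ⊤ ∷ map row (allFin m)

  dual : Family n
  dual = family (deduplicate _≟ₛ_ rows) (deduplicate-! _≟ₛ_ rows)

  card-dual≤1+m : card dual ≤ suc m
  card-dual≤1+m = ≤-trans (length-deduplicate _≟ₛ_ rows)
    (s≤s (≤-reflexive (trans (length-map row (allFin m)) (length-tabulate (λ r → r)))))

  ⊤∈dual : ⊤ ∈ members dual
  ⊤∈dual = ∈-deduplicate⁺ _≟ₛ_ {xs = rows} (here refl)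

  row∈dual : ∀ r → row r ∈ members dual
  row∈dual r = ∈-deduplicate⁺ _≟ₛ_ (there (∈-map⁺ row (∈-allFin r)))

  lookup-row : ∀ r i → lookup (row r) i ≡ lookup (T i) r
  lookup-row r i = lookup∘tabulate _ i

  dual-realizes : ∀ {k} → Unique L → All (λ A → ∣ A ∣ ≡ k) L → k + k < m → ∀ {i j} → i ≢ j → Realizes dual i j
  dual-realizes {k} distinct sizes 2k<m {i} {j} i≢j = realizes
    where
    ∣T∣≡k : ∀ i → ∣ T i ∣ ≡ k
    ∣T∣≡k i = All.lookup sizes (∈-lookup _)
    T-injective : ∀ {i j} → i ≢ j → T i ≢ T j
    T-injective i≢j = i≢j ∘ inject≤-injective _ _ _ _ ∘ lookup-injective distinct
    T⊈T : ∀ {i j} → i ≢ j → T i ⊈ T j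
    T⊈T {i} {j} i≢j = ∣q∣≤∣p∣⇒p≢q⇒p⊈q (T i) (T j) (≤-reflexive (trans (∣T∣≡k j) (sym (∣T∣≡k i)))) (T-injective i≢j)
    realizes : Realizes dual i j
    realizes true true = ⊤ , ⊤∈dual , lookup-replicate i true , lookup-replicate j true
    realizes true false with T⊈T i≢j
    ... | r , r∈Ti , r∉Tj = row r , row∈dual r , trans (lookup-row r i) r∈Ti , trans (lookup-row r j) r∉Tj
    realizes false true with T⊈T (i≢j ∘ sym)
    ... | r , r∈Tj , r∉Ti = row r , row∈dual r , trans (lookup-row r i) r∉Ti , trans (lookup-row r j) r∈Tj
    realizes false false with ∣p∣+∣q∣<n⇒∃∉p∪q (T i) (T j) (subst (_< m) (sym (cong₂ _+_ (∣T∣≡k i) (∣T∣≡k j))) 2k<m)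
    ... | r , r∉Ti , r∉Tj = row r , row∈dual r , trans (lookup-row r i) r∉Ti , trans (lookup-row r j) r∉Tj

  dual-¬shattersAll : StartsCovered L → 3 ≤ n → ∀ e → 3 ≤ e → e ≤ n → ¬ ShattersAll dual e
  dual-¬shattersAll (a , b , c , rest , refl , covered) (s≤s (s≤s (s≤s _))) = ¬shattersAll-beyond-2 dual misses-011
    where
    misses-011 : ∀ E → E ∈ members dual → lookup E zero ≡ false → lookup E (suc zero) ≡ true
      → lookup E (suc (suc zero)) ≡ true → ⊥
    misses-011 E E∈dual with ∈-deduplicate⁻ _≟ₛ_ rows E∈dual
    ... | here refl = λ ()
    ... | there E∈rows with ∈-map⁻ row E∈rows
    ...   | r , _ , refl = λ r∉a r∈b r∈c → contradiction (trans (sym (lookup-row r zero)) r∉a)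
      (not-¬ (covered r (trans (sym (lookup-row r (suc zero))) r∈b) (trans (sym (lookup-row r (suc (suc zero)))) r∈c)))

  dual-index-2 : ∀ {k} → Unique L → All (λ A → ∣ A ∣ ≡ k) L → k + k < m → StartsCovered L → 2 ≤ n
    → HasIndex dual 2
  dual-index-2 distinct sizes 2k<m covered 2≤n =
    2≤n , realizes⇒shattersAll2 dual (dual-realizes distinct sizes 2k<m) , at-most-2
    where
    at-most-2 : ∀ e → e ≤ n → ShattersAll dual e → e ≤ 2
    at-most-2 e e≤n shatters with e ≤? 2
    ... | yes e≤2 = e≤2
    ... | no e≰2 = ⊥-elim (dual-¬shattersAll covered (≤-trans (≰⇒> e≰2) e≤n) e (≰⇒> e≰2) e≤n shatters)

2[1+l]+1≡[1+l]+[2+l] : ∀ l → 2 * suc l + 1 ≡ suc l + suc (suc l)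
2[1+l]+1≡[1+l]+[2+l] = solve-∀

index-2⇒2[1+l]≤card : ∀ l {n} → (l + suc l) C l < n → (F : Family n) → HasIndex F 2 → 2 * suc l ≤ card F
index-2⇒2[1+l]≤card l {n} Cl<n F (_ , shatters , _) = ≮⇒≥ λ card<2[1+l] →
  <⇒≱ Cl<n (n≤[2l+1]Cl l F shatters (subst (card F ≤_) (l+[1+l+0]≡1+2l l) (s≤s⁻¹ card<2[1+l])))
  where
  l+[1+l+0]≡1+2l : ∀ l → l + suc (l + 0) ≡ suc (l + l)
  l+[1+l+0]≡1+2l = solve-∀

∃index-2-card≤2[1+l]+2 : ∀ l {n} → 2 ≤ n → n ≤ (2 * suc l + 1) C suc l
  → ∃ λ (F : Family n) → HasIndex F 2 × card F ≤ 2 * suc l + 2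
∃index-2-card≤2[1+l]+2 l {n} 2≤n n≤C = dual ,
  dual-index-2 (subsetsOfSize-unique M (suc l)) (∣subsetsOfSize∣ M (suc l)) 2[1+l]<M (subsetsOfSize-startsCovered l l) 2≤n ,
  subst (card dual ≤_) (1+M≡2[1+l]+2 l) card-dual≤1+m
  where
  M = suc l + suc (suc l)
  1+M≡2[1+l]+2 : ∀ l → suc (suc l + suc (suc l)) ≡ 2 * suc l + 2
  1+M≡2[1+l]+2 = solve-∀
  2[1+l]<M : suc l + suc l < M
  2[1+l]<M = +-monoʳ-< (suc l) (n<1+n (suc l))
  n≤∣L∣ : n ≤ length (subsetsOfSize M (suc l))
  n≤∣L∣ = subst (n ≤_) (sym (length-subsetsOfSize M (suc l))) (subst (λ m → n ≤ m C suc l) (2[1+l]+1≡[1+l]+[2+l] l) n≤C)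
  open Dual (subsetsOfSize M (suc l)) n≤∣L∣

corollary3 : (l n : ℕ) → 1 ≤ l → ((2 * l ∸ 1) C (l ∸ 1)) < n → n ≤ ((2 * l + 1) C l)
    → ∃ λ c → IsC 2 n c × 2 * l ≤ c × c ≤ 2 * l + 2
-- For l := suc l, the bound 2 * l ∸ 1 reduces to l + suc (l + 0).
corollary3 (suc l) n _ C<n n≤C =
  C-between (index-2⇒2[1+l]≤card l C<n′) (∃index-2-card≤2[1+l]+2 l 2≤n n≤C)
  where
  C<n′ : (l + suc l) C l < n
  C<n′ = subst (λ k → (l + suc k) C l < n) (+-identityʳ l) C<n
  2≤n : 2 ≤ n
  2≤n = ≤-trans (s≤s (0<[m+n]Cm l (suc l))) C<n′
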